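{- In the unstratified type and effect system, the following rule is derivable: if $r:A\xrightarrow{e}B\in R$, $r\in e$, and $R;\Gamma,f:A\xrightarrow{e}B\vdash M:(A\xrightarrow{e}B,\emptyset)$, then $R;\Gamma\vdash \mathsf{fix}_r f.M:(A\xrightarrow{e}B,\emptyset)$.
   Context: Syntax. Variables $x,y,\ldots$; regions $r,s,\ldots$; effects $e$ are finite sets of regions. Types: $A ::= \mathbf{1} \mid \mathrm{Reg}_r A \mid A\xrightarrow{e}A$. Region contexts $R=r_1:A_1,\ldots,r_n:A_n$ (distinct regions), $\mathrm{dom}(R)=\{r_1,\ldots,r_n\}$, $R(r_i)=A_i$; contexts $\Gamma=x_1:A_1,\ldots$. Terms $M ::= x\mid r\mid *\mid \lambda x.M\mid MM\mid \mathsf{get}(M)\mid\mathsf{set}(M,M)$; $[N/x]M$ is substitution. Define $\mathsf{fix}_r f.M = \lambda x.\,\big(\mathsf{get}((\lambda z.r)\,\mathsf{set}(r,\lambda x.([\lambda x.\mathsf{get}(r)\,x/f]M)\,x))\big)\,x$ with $z$ fresh. Unstratified well-formedness. Compatibility: $R\Vdash\mathbf 1$; if $R\Vdash A$, $R\Vdash B$, $e\subseteq\mathrm{dom}(R)$ then $R\Vdash A\xrightarrow{e}B$; if $r:A\in R$ then $R\Vdash\mathrm{Reg}_rA$. $R\vdash$ iff $R\Vdash R(r)$ for all $r\in\mathrm{dom}(R)$; $R\vdash A$ iff $R\vdash$ and $R\Vdash A$; $R\vdash(A,e)$ iff $R\vdash A$ and $e\subseteq\mathrm{dom}(R)$; $R\vdash\Gamma$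 iff $R\vdash$ and $R\vdash A_i$ for each $x_i:A_i\in\Gamma$. Subtyping: if $R\vdash A$ then $R\vdash A\le A$; if $R\vdash A'\le A$, $R\vdash B\le B'$, $e\subseteq e'\subseteq\mathrm{dom}(R)$ then $R\vdash (A\xrightarrow{e}B)\le(A'\xrightarrow{e'}B')$; if $R\vdash A\le A'$ and $e\subseteq e'\subseteq\mathrm{dom}(R)$ then $R\vdash(A,e)\le(A',e')$. Typing: if $R\vdash\Gamma$, $x:A\in\Gamma$ then $R;\Gamma\vdash x:(A,\emptyset)$; if $R\vdash\Gamma$, $r:A\in R$ then $R;\Gamma\vdash r:(\mathrm{Reg}_rA,\emptyset)$; if $R\vdash\Gamma$ then $R;\Gamma\vdash *:(\mathbf 1,\emptyset)$; from $R;\Gamma,x:A\vdash M:(B,e)$ infer $R;\Gamma\vdash\lambda x.M:(A\xrightarrow{e}B,\emptyset)$; from $R;\Gamma\vdash M:(A\xrightarrow{e_2}B,e_1)$ and $R;\Gamma\vdash N:(A,e_3)$ infer $R;\Gamma\vdash MN:(B,e_1\cup e_2\cup e_3)$; from $R;\Gamma\vdash M:(\mathrm{Reg}_rA,e)$ infer $R;\Gamma\vdash\mathsf{get}(M):(A,e\cup\{r\})$; from $R;\Gamma\vdash M:(\mathrm{Reg}_rA,e_1)$ and $R;\Gamma\vdash N:(A,e_2)$ infer $R;\Gamma\vdash\mathsf{set}(M,N):(\mathbf 1,e_1\cup e_2\cup\{r\})$; from $R;\Gamma\vdash M:(A,e)$ and $R\vdash(A,e)\le(A',e')$ infer $R;\Gamma\vdash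 M:(A',e')$. -}

module Defs where

open import Data.Nat using (ℕ; _≟_)
open import Data.Product using (_×_; _,_; proj₁)
open import Data.List using (List; []; _∷_; _++_; map)
open import Data.List.Membership.Propositional using (_∈_; _∉_)
open import Data.List.Relation.Binary.Subset.Propositional using (_⊆_)
open import Data.List.Relation.Unary.All using (All)
open import Data.List.Relation.Unary.Unique.Propositional using (Unique)
open import Relation.Nullary using (yes; no; ¬_)
open import Relation.Binary.PropositionalEquality using (_≡_; _≢_)

Var : Set
Var = ℕ

Region : Set
Region = ℕ

-- Effects: finite sets of regions, represented by lists; set operations are
-- read up to membership (⊆ is list inclusion, ∪ is ++, ∅ is []).
Eff : Set
Eff = List Region

data Ty : Set where
  𝟙    : Ty
  Reg  : Region → Ty → Ty
  _⟶[_]_ : Ty → Eff → Ty → Ty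

data Tm : Set where
  var  : Var → Tm
  reg  : Region → Tm
  ⋆    : Tm
  lam  : Var → Tm → Tm
  app  : Tm → Tm → Tm
  get  : Tm → Tm
  set  : Tm → Tm → Tm

-- Substitution [N/x]M.  It does not rename binders; it is capture-avoiding
-- whenever N is closed, which is the only use made of it below (in fix).
sub : Tm → Var → Tm → Tm
sub N x (var y) with x ≟ y
... | yes _ = N
... | no  _ = var y
sub N x (reg r) = reg r
sub N x ⋆ = ⋆
sub N x (lam y M) with x ≟ y
... | yes _ = lam y M
... | no  _ = lam y (sub N x M)
sub N x (app M M') = app (sub N x M) (sub N x M')
sub N x (get M) = get (sub N x M)
sub N x (set M M') = set (sub N x M) (sub N x M')

fv : Tm → List Var
fv (var y) = y ∷ []
fv (reg r) = []
fv ⋆ = []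
fv (lam y M) = Data.List.filter (λ z → Relation.Nullary.¬? (y ≟ z)) (fv M)
  where import Relation.Nullary
fv (app M N) = fv M ++ fv N
fv (get M) = fv M
fv (set M N) = fv M ++ fv N

-- fix_r f.M = λx. (get((λz.r) set(r, λx.([λx.get(r) x / f]M) x))) x
-- (x and z are the bound names used; z is fresh, x must be fresh for M)
fixTm : Region → Var → Tm → Var → Var → Tm
fixTm r f M x z =
  lam x (app (get (app (lam z (reg r))
                       (set (reg r)
                            (lam x (app (sub (lam x (app (get (reg r)) (var x))) f M)
                                        (var x))))))
             (var x))

RCtx : Set
RCtx = List (Region × Ty)

Ctx : Set
Ctx = List (Var × Ty)

dom : RCtx → List Region
dom R = map proj₁ R

-- x : A ∈ Γ  (the most recent binding of x, so later bindings shadow)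
data _∶_∈ᶜ_ : Var → Ty → Ctx → Set where
  here  : ∀ {x A Γ} → x ∶ A ∈ᶜ ((x , A) ∷ Γ)
  there : ∀ {x y A B Γ} → x ≢ y → x ∶ A ∈ᶜ Γ → x ∶ A ∈ᶜ ((y , B) ∷ Γ)

data _⊩_ (R : RCtx) : Ty → Set where
  ⊩𝟙   : R ⊩ 𝟙
  ⊩arr : ∀ {A B e} → R ⊩ A → R ⊩ B → e ⊆ dom R → R ⊩ (A ⟶[ e ] B)
  ⊩reg : ∀ {r A} → (r , A) ∈ R → R ⊩ Reg r A

WfR : RCtx → Set
WfR R = Unique (dom R) × All (λ p → R ⊩ Data.Product.proj₂ p) R

WfTy : RCtx → Ty → Set
WfTy R A = WfR R × R ⊩ A

WfCtx : RCtx → Ctx → Set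
WfCtx R Γ = WfR R × All (λ p → WfTy R (Data.Product.proj₂ p)) Γ

data _⊢_≤_ (R : RCtx) : Ty → Ty → Set where
  ≤-refl : ∀ {A} → WfTy R A → R ⊢ A ≤ A
  ≤-arr  : ∀ {A A' B B' e e'} → R ⊢ A' ≤ A → R ⊢ B ≤ B' →
           e ⊆ e' → e' ⊆ dom R → R ⊢ (A ⟶[ e ] B) ≤ (A' ⟶[ e' ] B')

_⊢⟨_,_⟩≤⟨_,_⟩ : RCtx → Ty → Eff → Ty → Eff → Set
R ⊢⟨ A , e ⟩≤⟨ A' , e' ⟩ = R ⊢ A ≤ A' × e ⊆ e' × e' ⊆ dom R

data _︔_⊢_∶⟨_,_⟩ (R : RCtx) (Γ : Ctx) : Tm → Ty → Eff → Set where
  t-var : ∀ {x A} → WfCtx R Γ → x ∶ A ∈ᶜ Γ → R ︔ Γ ⊢ var x ∶⟨ A , [] ⟩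
  t-reg : ∀ {r A} → WfCtx R Γ → (r , A) ∈ R → R ︔ Γ ⊢ reg r ∶⟨ Reg r A , [] ⟩
  t-one : WfCtx R Γ → R ︔ Γ ⊢ ⋆ ∶⟨ 𝟙 , [] ⟩
  t-lam : ∀ {x M A B e} → R ︔ ((x , A) ∷ Γ) ⊢ M ∶⟨ B , e ⟩ →
          R ︔ Γ ⊢ lam x M ∶⟨ (A ⟶[ e ] B) , [] ⟩
  t-app : ∀ {M N A B e₁ e₂ e₃} → R ︔ Γ ⊢ M ∶⟨ (A ⟶[ e₂ ] B) , e₁ ⟩ →
          R ︔ Γ ⊢ N ∶⟨ A , e₃ ⟩ → R ︔ Γ ⊢ app M N ∶⟨ B , (e₁ ++ e₂ ++ e₃) ⟩
  t-get : ∀ {M r A e} → R ︔ Γ ⊢ M ∶⟨ Reg r A , e ⟩ →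
          R ︔ Γ ⊢ get M ∶⟨ A , (e ++ r ∷ []) ⟩
  t-set : ∀ {M N r A e₁ e₂} → R ︔ Γ ⊢ M ∶⟨ Reg r A , e₁ ⟩ →
          R ︔ Γ ⊢ N ∶⟨ A , e₂ ⟩ → R ︔ Γ ⊢ set M N ∶⟨ 𝟙 , (e₁ ++ e₂ ++ r ∷ []) ⟩
  t-sub : ∀ {M A e A' e'} → R ︔ Γ ⊢ M ∶⟨ A , e ⟩ → R ⊢⟨ A , e ⟩≤⟨ A' , e' ⟩ →
          R ︔ Γ ⊢ M ∶⟨ A' , e' ⟩

module Submission where

-- The recursion operator fix_r f.M is derivable by "backpatching": the
-- function stored in the region r : A -e-> B is used for the recursive calls.
-- Concretely, fix_r f.M = λx. get((λz.r) set(r, λx. M' x)) x where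
-- M' = [N/f]M and N = λx. get(r) x.
--
-- Then the three building
-- blocks of fix are typed separately: the unrolling N, the η-expansion
-- λx. M' x, and the backpatching get((λz.r) set(r, V)).  Since r ∈ e, the
-- region effects these produce are absorbed by the latent effect e, so the
-- theorem follows by assembling the blocks.

open import Defs
open import Data.Product using (_,_)
open import Data.List using (List; []; _∷_)
open import Data.List.Membership.Propositional using (_∈_; _∉_)

open import Data.Product using (proj₁; proj₂)
open import Data.List using (_++_)
open import Data.List.Properties using (++-identityʳ)
open import Data.List.Relation.Unary.Any using (here)
open import Data.List.Relation.Unary.All as All using (_∷_)
open import Data.List.Membership.Propositional.Properties
  using (∈-++⁺ˡ; ∈-++⁺ʳ; ∈-filter⁺; ∈-filter⁻)
open import Data.List.Relation.Binary.Subset.Propositional using (_⊆_)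
open import Data.List.Relation.Binary.Subset.Propositional.Properties
  using (⊆-reflexive; ∈-∷⁺ʳ)
open import Data.Nat using (_≟_)
open import Data.Empty using (⊥-elim)
open import Relation.Nullary using (yes; no; ¬?)
open import Relation.Binary.PropositionalEquality using (_≡_; refl; sym; _≢_; subst)

typing⇒wfCtx : ∀ {R Δ M T ε} → R ︔ Δ ⊢ M ∶⟨ T , ε ⟩ → WfCtx R Δ
typing⇒wfCtx (t-var w _) = w
typing⇒wfCtx (t-reg w _) = w
typing⇒wfCtx (t-one w) = w
typing⇒wfCtx (t-lam d) with typing⇒wfCtx d
... | w , _ ∷ ws = w , ws
typing⇒wfCtx (t-app d _) = typing⇒wfCtx d
typing⇒wfCtx (t-get d) = typing⇒wfCtx d
typing⇒wfCtx (t-set d _) = typing⇒wfCtx d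
typing⇒wfCtx (t-sub d _) = typing⇒wfCtx d

wfCtx-extend : ∀ {R Δ T} (y : Var) → WfCtx R Δ → WfTy R T → WfCtx R ((y , T) ∷ Δ)
wfCtx-extend y (w , ws) wT = w , wT ∷ ws

region-wfTy : ∀ {R r C} → WfR R → (r , C) ∈ R → WfTy R C
region-wfTy wR rC = wR , All.lookup (proj₂ wR) rC

arrow-domain : ∀ {R A B e} → WfTy R (A ⟶[ e ] B) → WfTy R A
arrow-domain (wR , ⊩arr a _ _) = wR , a

arrow-codomain : ∀ {R A B e} → WfTy R (A ⟶[ e ] B) → WfTy R B
arrow-codomain (wR , ⊩arr _ b _) = wR , b

arrow-effect : ∀ {R A B e} → WfTy R (A ⟶[ e ] B) → e ⊆ dom R
arrow-effect (_ , ⊩arr _ _ e⊆) = e⊆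

weaken-effect : ∀ {R Δ M T ε ε'} → R ︔ Δ ⊢ M ∶⟨ T , ε ⟩ → WfTy R T →
                ε ⊆ ε' → ε' ⊆ dom R → R ︔ Δ ⊢ M ∶⟨ T , ε' ⟩
weaken-effect d wT ε⊆ε' ε'⊆R = t-sub d (≤-refl wT , ε⊆ε' , ε'⊆R)

lookup-unique : ∀ {y A B Δ} → y ∶ A ∈ᶜ Δ → y ∶ B ∈ᶜ Δ → A ≡ B
lookup-unique here here = refl
lookup-unique here (there y≢y _) = ⊥-elim (y≢y refl)
lookup-unique (there y≢y _) here = ⊥-elim (y≢y refl)
lookup-unique (there _ p) (there _ q) = lookup-unique p q

fv-lam⁺ : ∀ {y z M} → z ∈ fv M → z ≢ y → z ∈ fv (lam y M)
fv-lam⁺ {y} z∈M z≢y = ∈-filter⁺ (λ w → ¬? (y ≟ w)) z∈M (λ y≡z → z≢y (sym y≡z))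

fv-lam⁻ : ∀ {y z M} → z ∈ fv (lam y M) → z ≢ y
fv-lam⁻ {y} {M = M} z∈λ y≡z =
  proj₂ (∈-filter⁻ (λ w → ¬? (y ≟ w)) {xs = fv M} z∈λ) (sym y≡z)

AgreeOn : (Var → Set) → Ctx → Ctx → Set
AgreeOn P Δ Δ' = ∀ {y A} → P y → y ∶ A ∈ᶜ Δ → y ∶ A ∈ᶜ Δ'

agreeOn-mono : ∀ {P Q : Var → Set} {Δ Δ'} →
               (∀ {y} → Q y → P y) → AgreeOn P Δ Δ' → AgreeOn Q Δ Δ'
agreeOn-mono Q⇒P ag q = ag (Q⇒P q)

agreeOn-bind : ∀ {P Q : Var → Set} {Δ Δ' y A} →
               (∀ {z} → Q z → z ≢ y → P z) → AgreeOn P Δ Δ' →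
               AgreeOn Q ((y , A) ∷ Δ) ((y , A) ∷ Δ')
agreeOn-bind Q⇒P ag q here = here
agreeOn-bind Q⇒P ag q (there z≢y p) = there z≢y (ag (Q⇒P q z≢y) p)

weaken : ∀ {R Δ Δ' M T ε} → R ︔ Δ ⊢ M ∶⟨ T , ε ⟩ → WfCtx R Δ' →
         AgreeOn (_∈ fv M) Δ Δ' → R ︔ Δ' ⊢ M ∶⟨ T , ε ⟩
weaken (t-var _ p) w ag = t-var w (ag (here refl) p)
weaken (t-reg _ p) w ag = t-reg w p
weaken (t-one _) w ag = t-one w
weaken (t-lam {M = M} d) w ag with typing⇒wfCtx d
... | _ , wA ∷ _ =
  t-lam (weaken d (wfCtx-extend _ w wA) (agreeOn-bind (fv-lam⁺ {M = M}) ag))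
weaken (t-app {M} d d') w ag =
  t-app (weaken d w (agreeOn-mono ∈-++⁺ˡ ag))
        (weaken d' w (agreeOn-mono (∈-++⁺ʳ (fv M)) ag))
weaken (t-get d) w ag = t-get (weaken d w ag)
weaken (t-set {M} d d') w ag =
  t-set (weaken d w (agreeOn-mono ∈-++⁺ˡ ag))
        (weaken d' w (agreeOn-mono (∈-++⁺ʳ (fv M)) ag))
weaken (t-sub d s) w ag = t-sub (weaken d w ag) s

Portable : RCtx → Tm → Ty → Set
Portable R N C = ∀ {Δ} → WfCtx R Δ → R ︔ Δ ⊢ N ∶⟨ C , [] ⟩

record FreeExcept (f : Var) (M : Tm) (y : Var) : Set where
  constructor _,_
  field
    free : y ∈ fv M
    not-f : y ≢ f

freeExcept-mono : ∀ {f M M'} → fv M ⊆ fv M' →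
                  ∀ {y} → FreeExcept f M y → FreeExcept f M' y
freeExcept-mono M⊆M' (y∈M , y≢f) = M⊆M' y∈M , y≢f

freeExcept-lam : ∀ {f y M z} → FreeExcept f M z → z ≢ y → FreeExcept f (lam y M) z
freeExcept-lam {M = M} (z∈M , z≢f) z≢y = fv-lam⁺ {M = M} z∈M z≢y , z≢f

-- Substitution lemma for a portable term N, into any well-formed context
-- agreeing on the free variables other than f.  Portability makes the
-- substitution capture-free at the level of typing.
substitution : ∀ {R Δ Δ' M T ε f C N} → Portable R N C → f ∶ C ∈ᶜ Δ →
               R ︔ Δ ⊢ M ∶⟨ T , ε ⟩ → WfCtx R Δ' →
               AgreeOn (FreeExcept f M) Δ Δ' → R ︔ Δ' ⊢ sub N f M ∶⟨ T , ε ⟩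
substitution {f = f} hN fC (t-var {y} _ p) w ag with f ≟ y
... | yes refl = subst (λ T → _ ︔ _ ⊢ _ ∶⟨ T , [] ⟩) (lookup-unique fC p) (hN w)
... | no f≢y = t-var w (ag (here refl , λ y≡f → f≢y (sym y≡f)) p)
substitution hN fC (t-reg _ p) w ag = t-reg w p
substitution hN fC (t-one _) w ag = t-one w
substitution {f = f} hN fC (t-lam {y} {M} d) w ag with f ≟ y | typing⇒wfCtx d
... | yes refl | _ =
  weaken (t-lam d) w (agreeOn-mono (λ z∈λ → z∈λ , fv-lam⁻ {M = M} z∈λ) ag)
... | no f≢y | _ , wA ∷ _ =
  t-lam (substitution hN (there f≢y fC) d (wfCtx-extend _ w wA)
           (agreeOn-bind freeExcept-lam ag))
substitution hN fC (t-app {M} d d') w ag =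
  t-app (substitution hN fC d w (agreeOn-mono (freeExcept-mono ∈-++⁺ˡ) ag))
        (substitution hN fC d' w (agreeOn-mono (freeExcept-mono (∈-++⁺ʳ (fv M))) ag))
substitution hN fC (t-get d) w ag =
  t-get (substitution hN fC d w (agreeOn-mono (freeExcept-mono (λ y∈M → y∈M)) ag))
substitution hN fC (t-set {M} d d') w ag =
  t-set (substitution hN fC d w (agreeOn-mono (freeExcept-mono ∈-++⁺ˡ) ag))
        (substitution hN fC d' w (agreeOn-mono (freeExcept-mono (∈-++⁺ʳ (fv M))) ag))
substitution hN fC (t-sub d s) w ag = t-sub (substitution hN fC d w ag) s

++[]⊆ : (e : Eff) → (e ++ []) ⊆ e
++[]⊆ e = ⊆-reflexive (++-identityʳ e)

-- The unrolling λx. get(r) x of a region r : A -e-> B with r ∈ e is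
-- portable: reading r is absorbed by the latent effect e.
unrolling-portable : ∀ {R r A B e} (x : Var) → WfR R →
                     (r , (A ⟶[ e ] B)) ∈ R → r ∈ e →
                     Portable R (lam x (app (get (reg r)) (var x))) (A ⟶[ e ] B)
unrolling-portable {e = e} x wR rC r∈e w =
  t-sub (t-lam (t-app (t-get (t-reg wx rC)) (t-var wx here)))
        (≤-arr (≤-refl (arrow-domain wC)) (≤-refl (arrow-codomain wC))
               (∈-∷⁺ʳ r∈e (++[]⊆ e)) (arrow-effect wC) , (λ ()) , (λ ()))
  where
  wC = region-wfTy wR rC
  wx = wfCtx-extend x w (arrow-domain wC)

eta-expansion : ∀ {R Δ A B e M'} (x : Var) → WfTy R (A ⟶[ e ] B) →
                R ︔ ((x , A) ∷ Δ) ⊢ M' ∶⟨ (A ⟶[ e ] B) , [] ⟩ →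
                R ︔ Δ ⊢ lam x (app M' (var x)) ∶⟨ (A ⟶[ e ] B) , [] ⟩
eta-expansion {e = e} x wC dM' =
  t-lam (weaken-effect (t-app dM' (t-var (typing⇒wfCtx dM') here))
                       (arrow-codomain wC) (++[]⊆ e) (arrow-effect wC))

backpatch : ∀ {R Δ r C V} (z : Var) → (r , C) ∈ R →
            R ︔ Δ ⊢ V ∶⟨ C , [] ⟩ →
            R ︔ Δ ⊢ get (app (lam z (reg r)) (set (reg r) V)) ∶⟨ C , (r ∷ r ∷ []) ⟩
backpatch z rC dV =
  t-get (t-app (t-lam (t-reg (wfCtx-extend z w (proj₁ w , ⊩𝟙)) rC))
               (t-set (t-reg w rC) dV))
  where w = typing⇒wfCtx dV

proposition3 : ∀ (R : RCtx) (Γ : Ctx) (r : Region) (A B : Ty) (e : Eff)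
    (f : Var) (M : Tm) (x z : Var) →
    (r , (A ⟶[ e ] B)) ∈ R → r ∈ e →
    R ︔ ((f , (A ⟶[ e ] B)) ∷ Γ) ⊢ M ∶⟨ (A ⟶[ e ] B) , [] ⟩ →
    x ∉ fv M →
    R ︔ Γ ⊢ fixTm r f M x z ∶⟨ (A ⟶[ e ] B) , [] ⟩
proposition3 R Γ r A B e f M x z rC r∈e dM x∉M with typing⇒wfCtx dM
... | wR , _ ∷ wΓ =
  t-lam (weaken-effect (t-app (backpatch z rC recursiveBody) (t-var wΓx here))
                       (arrow-codomain wC)
                       (∈-∷⁺ʳ r∈e (∈-∷⁺ʳ r∈e (++[]⊆ e))) (arrow-effect wC))
  where
  wC = region-wfTy wR rC
  wΓx = wfCtx-extend x (wR , wΓ) (arrow-domain wC)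
  -- M is typed in f : C, Γ; x is bound twice above Γ but is not free in M.
  agree : AgreeOn (FreeExcept f M) ((f , (A ⟶[ e ] B)) ∷ Γ) ((x , A) ∷ (x , A) ∷ Γ)
  agree (_ , y≢f) here = ⊥-elim (y≢f refl)
  agree {y} (y∈M , _) (there _ p) with y ≟ x
  ... | yes refl = ⊥-elim (x∉M y∈M)
  ... | no y≢x = there y≢x (there y≢x p)
  recursiveBody = eta-expansion x wC
    (substitution (unrolling-portable x wR rC r∈e) here dM
                  (wfCtx-extend x wΓx (arrow-domain wC)) agree)
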